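{- Let $q$ be an odd prime power and let $t, r_1, r_2 \in \mathbb{F}_q$ be non-zero with $D(t,r_1,r_2) = 0$, where \[D(t,r_1,r_2) = t^2 + r_1^2 + r_2^2 - 2(tr_1 + tr_2 + r_1r_2).\] Then $\eta(t) = \eta(r_1) = \eta(r_2)$.
   Context: $\mathbb{F}_q$ is the finite field with $q$ elements, and $\eta$ is the quadratic character on $\mathbb{F}_q$: $\eta(0)=0$, $\eta(x)=1$ if $x$ is a non-zero square, $\eta(x)=-1$ if $x$ is a non-square. -}

module Defs where

open import Level using (0ℓ)
open import Data.Nat using (ℕ; _≥_)
open import Data.Nat.Primality using (Prime)
open import Data.Fin using (Fin)
open import Data.Fin.Properties using (any?)
open import Data.Integer using (ℤ; +_; -[1+_])
open import Data.Product using (∃; ∃-syntax; _×_; _,_)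
open import Relation.Nullary using (¬_; Dec; yes; no)
open import Relation.Binary.PropositionalEquality using (_≡_; _≢_)
open import Relation.Binary.Definitions using (DecidableEquality)
open import Algebra.Structures using (IsCommutativeRing)
open import Function.Bundles using (_↔_; Inverse)

OddPrimePower : ℕ → Set
OddPrimePower q = ∃[ p ] ∃[ k ] (Prime p × p ≢ 2 × k ≥ 1 × q ≡ p Data.Nat.^ k)

record FiniteField (q : ℕ) : Set₁ where
  infixl 7 _*_
  infixl 6 _+_ _-_
  field
    Carrier : Set
    _+_ _*_ : Carrier → Carrier → Carrier
    -_      : Carrier → Carrier
    0# 1#   : Carrier
    isCommutativeRing : IsCommutativeRing _≡_ _+_ _*_ -_ 0# 1#
    0≢1     : 0# ≢ 1#
    inverse : ∀ x → x ≢ 0# → ∃[ y ] (x * y ≡ 1#)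
    _≟_     : DecidableEquality Carrier
    enum    : Fin q ↔ Carrier

  _-_ : Carrier → Carrier → Carrier
  x - y = x + (- y)

  2# : Carrier
  2# = 1# + 1#

  D : Carrier → Carrier → Carrier → Carrier
  D t r₁ r₂ = t * t + r₁ * r₁ + r₂ * r₂ - 2# * (t * r₁ + t * r₂ + r₁ * r₂)

  private
    elem : Fin q → Carrier
    elem = Inverse.to enum

  isSquare? : ∀ x → Dec (∃[ i ] (elem i * elem i ≡ x))
  isSquare? x = any? (λ i → (elem i * elem i) ≟ x)

  η : Carrier → ℤ
  η x with x ≟ 0#
  ... | yes _ = + 0
  ... | no _ with isSquare? x
  ...   | yes _ = + 1
  ...   | no _  = -[1+ 0 ]

-- Completing the square, D(t, r₁, r₂) = (t − r₁ − r₂)² − 4 r₁ r₂, so D = 0 makes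
-- r₁ r₂ a square once 2 is invertible; as D is symmetric, t r₁ is a square too.
-- A product of two non-zero elements that is a square forces both factors to be
-- squares or both to be non-squares, so η agrees on t, r₁ and r₂. In
-- characteristic 2 squaring is injective, hence surjective on a finite field, and
-- every non-zero element has η = 1.
module Submission where

open import Defs
open import Data.Nat using (ℕ; zero; suc)
open import Data.Nat.Properties using (1+n≰n)
open import Data.Fin using (Fin; punchOut)
open import Data.Fin.Properties using (any?; punchOut-injective; injective⇒≤)
open import Data.Integer using (+_; -[1+_])
open import Data.Product using (_×_; _,_; ∃-syntax; map)
open import Function using (_∘_)
open import Function.Bundles using (_↔_; Inverse)
open import Relation.Nullary using (¬_; Dec; yes; no; contradiction)
open import Relation.Nullary.Decidable using (map′)
open import Relation.Binary.PropositionalEquality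
open import Algebra.Bundles using (CommutativeRing)
import Algebra.Properties.Ring as RingProperties
import Algebra.Solver.Ring.NaturalCoefficients.Default as RingSolver

Fin-injective⇒surjective : ∀ {n} (f : Fin n → Fin n) →
                           (∀ {i j} → f i ≡ f j → i ≡ j) → ∀ y → ∃[ i ] (f i ≡ y)
Fin-injective⇒surjective {zero}  f f-inj ()
Fin-injective⇒surjective {suc n} f f-inj y with any? (λ i → f i Data.Fin.≟ y)
... | yes hit = hit
... | no miss = contradiction (injective⇒≤ punchOut-inj) (1+n≰n {n})
  where
    y≢f : ∀ i → y ≢ f i
    y≢f i y≡fi = miss (i , sym y≡fi)
    punchOut-inj : ∀ {i j} → punchOut (y≢f i) ≡ punchOut (y≢f j) → i ≡ j
    punchOut-inj = f-inj ∘ punchOut-injective (y≢f _) (y≢f _)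

module _ {A : Set} {n : ℕ} (enum : Fin n ↔ A) where
  open Inverse enum

  finite-injective⇒surjective : (f : A → A) → (∀ {x y} → f x ≡ f y → x ≡ y) →
                                ∀ y → ∃[ x ] (f x ≡ y)
  finite-injective⇒surjective f f-inj y =
    map to from-injective (Fin-injective⇒surjective (from ∘ f ∘ to) g-inj (from y))
    where
      from-injective : ∀ {x y} → from x ≡ from y → x ≡ y
      from-injective eq = trans (sym (inverseˡ refl)) (trans (cong to eq) (inverseˡ refl))
      g-inj : ∀ {i j} → from (f (to i)) ≡ from (f (to j)) → i ≡ j
      g-inj eq = trans (sym (inverseʳ refl)) (trans (cong from (f-inj (from-injective eq))) (inverseʳ refl))

module Squares {q : ℕ} (F : FiniteField q) where
  open FiniteField F
  open Inverse enum using (to; from; inverseˡ)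

  private
    ring : CommutativeRing _ _
    ring = record { isCommutativeRing = isCommutativeRing }

  open CommutativeRing ring using (*-identityʳ; *-assoc; *-comm; zeroˡ; +-identityˡ)
  open RingProperties (CommutativeRing.ring ring) using (+-cancelʳ; x∙y⁻¹≈ε⇒x≈y; //-rightDividesˡ)
  -- The solver only knows natural-number coefficients, so subtractions are
  -- eliminated by hand (via x ≡ x - y + y and cancellation) before calling it.
  open RingSolver (CommutativeRing.commutativeSemiring ring) using (solve; _:+_; _:*_; _:=_; con)
  open ≡-Reasoning

  IsSquare : Carrier → Set
  IsSquare x = ∃[ y ] (y * y ≡ x)

  IsSquare⇒square-of-index : ∀ {x} → IsSquare x → ∃[ i ] (to i * to i ≡ x)
  IsSquare⇒square-of-index (y , y*y≡x) = from y , trans (cong (λ z → z * z) (inverseˡ refl)) y*y≡x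

  IsSquare? : ∀ x → Dec (IsSquare x)
  IsSquare? x = map′ (λ (i , eq) → to i , eq) IsSquare⇒square-of-index (isSquare? x)

  η-square : ∀ {x} → x ≢ 0# → IsSquare x → η x ≡ + 1
  η-square {x} x≢0 sq with x ≟ 0#
  ... | yes x≡0 = contradiction x≡0 x≢0
  ... | no _ with isSquare? x
  ...   | yes _  = refl
  ...   | no ¬sq = contradiction (IsSquare⇒square-of-index sq) ¬sq

  η-nonSquare : ∀ {x} → x ≢ 0# → ¬ IsSquare x → η x ≡ -[1+ 0 ]
  η-nonSquare {x} x≢0 ¬sq with x ≟ 0#
  ... | yes x≡0 = contradiction x≡0 x≢0
  ... | no _ with isSquare? x
  ...   | yes (i , eq) = contradiction (to i , eq) ¬sq
  ...   | no _         = refl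

  x*x≡0⇒x≡0 : ∀ {x} → x * x ≡ 0# → x ≡ 0#
  x*x≡0⇒x≡0 {x} x*x≡0 with x ≟ 0#
  ... | yes x≡0 = x≡0
  ... | no x≢0 with x⁻¹ , x*x⁻¹≡1 ← inverse x x≢0 = begin
    x              ≡⟨ sym (*-identityʳ x) ⟩
    x * 1#         ≡⟨ cong (x *_) (sym x*x⁻¹≡1) ⟩
    x * (x * x⁻¹)  ≡⟨ sym (*-assoc x x x⁻¹) ⟩
    x * x * x⁻¹    ≡⟨ cong (_* x⁻¹) x*x≡0 ⟩
    0# * x⁻¹       ≡⟨ zeroˡ x⁻¹ ⟩
    0#             ∎

  IsSquare-*-cancelˡ : ∀ {a b} → a ≢ 0# → IsSquare a → IsSquare (a * b) → IsSquare b
  IsSquare-*-cancelˡ {a} {b} a≢0 (x , x*x≡a) (c , c*c≡ab) with x ≟ 0#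
  ... | yes x≡0 = contradiction (trans (sym x*x≡a) (trans (cong (_* x) x≡0) (zeroˡ x))) a≢0
  ... | no x≢0 with x⁻¹ , x*x⁻¹≡1 ← inverse x x≢0 = c * x⁻¹ , (begin
    c * x⁻¹ * (c * x⁻¹)      ≡⟨ solve 2 (λ c u → c :* u :* (c :* u) := c :* c :* (u :* u)) refl c x⁻¹ ⟩
    c * c * (x⁻¹ * x⁻¹)      ≡⟨ cong (λ z → z * (x⁻¹ * x⁻¹)) (trans c*c≡ab (cong (_* b) (sym x*x≡a))) ⟩
    x * x * b * (x⁻¹ * x⁻¹)  ≡⟨ solve 3 (λ x b u → x :* x :* b :* (u :* u) := x :* u :* (x :* u) :* b) refl x b x⁻¹ ⟩
    x * x⁻¹ * (x * x⁻¹) * b  ≡⟨ cong (λ z → z * z * b) x*x⁻¹≡1 ⟩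
    1# * 1# * b              ≡⟨ solve 1 (λ b → con 1 :* con 1 :* b := b) refl b ⟩
    b                        ∎)

  η-cong-IsSquare-* : ∀ {a b} → a ≢ 0# → b ≢ 0# → IsSquare (a * b) → η a ≡ η b
  η-cong-IsSquare-* {a} {b} a≢0 b≢0 sq-ab with IsSquare? a | IsSquare? b
  ... | yes sq-a | yes sq-b = trans (η-square a≢0 sq-a) (sym (η-square b≢0 sq-b))
  ... | no ¬sq-a | no ¬sq-b = trans (η-nonSquare a≢0 ¬sq-a) (sym (η-nonSquare b≢0 ¬sq-b))
  ... | yes sq-a | no ¬sq-b = contradiction (IsSquare-*-cancelˡ a≢0 sq-a sq-ab) ¬sq-b
  ... | no ¬sq-a | yes sq-b =
    contradiction (IsSquare-*-cancelˡ b≢0 sq-b (subst IsSquare (*-comm a b) sq-ab)) ¬sq-a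

  x≡x-y+y : ∀ x y → x ≡ x - y + y
  x≡x-y+y x y = sym (//-rightDividesˡ y x)

  square-of-difference : ∀ x y → (x - y) * (x - y) + 2# * (x * y) ≡ x * x + y * y
  square-of-difference x y = begin
    d * d + 2# * (x * y)        ≡⟨ cong (λ z → d * d + 2# * (z * y)) (x≡x-y+y x y) ⟩
    d * d + 2# * ((d + y) * y)  ≡⟨ solve 2 (λ d y → d :* d :+ con 2 :* ((d :+ y) :* y)
                                                   := (d :+ y) :* (d :+ y) :+ y :* y) refl d y ⟩
    (d + y) * (d + y) + y * y   ≡⟨ cong (λ z → z * z + y * y) (sym (x≡x-y+y x y)) ⟩
    x * x + y * y               ∎
    where d = x - y

  D-rotate : ∀ t a b → D t a b ≡ D b t a
  D-rotate t a b = cong₂ (λ u v → u - 2# * v)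
    (solve 3 (λ t a b → t :* t :+ a :* a :+ b :* b := b :* b :+ t :* t :+ a :* a) refl t a b)
    (solve 3 (λ t a b → t :* a :+ t :* b :+ a :* b := b :* t :+ b :* a :+ t :* a) refl t a b)

  D≡0⇒square≡4* : ∀ {t a b} → D t a b ≡ 0# → (t - (a + b)) * (t - (a + b)) ≡ 2# * 2# * (a * b)
  D≡0⇒square≡4* {t} {a} {b} D≡0 = +-cancelʳ (2# * (t * (a + b))) _ _ (begin
    (t - (a + b)) * (t - (a + b)) + 2# * (t * (a + b))  ≡⟨ square-of-difference t (a + b) ⟩
    t * t + (a + b) * (a + b)                          ≡⟨ solve 3 (λ t a b → t :* t :+ (a :+ b) :* (a :+ b)
                                                            := t :* t :+ a :* a :+ b :* b :+ con 2 :* (a :* b)) refl t a b ⟩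
    t * t + a * a + b * b + 2# * (a * b)               ≡⟨ cong (_+ 2# * (a * b)) X≡2Y ⟩
    2# * (t * a + t * b + a * b) + 2# * (a * b)        ≡⟨ solve 3 (λ t a b → con 2 :* (t :* a :+ t :* b :+ a :* b) :+ con 2 :* (a :* b)
                                                            := con 2 :* con 2 :* (a :* b) :+ con 2 :* (t :* (a :+ b))) refl t a b ⟩
    2# * 2# * (a * b) + 2# * (t * (a + b))             ∎)
    where
      X≡2Y : t * t + a * a + b * b ≡ 2# * (t * a + t * b + a * b)
      X≡2Y = x∙y⁻¹≈ε⇒x≈y _ _ D≡0

  D≡0⇒IsSquare-* : ∀ {t a b} → 2# ≢ 0# → D t a b ≡ 0# → IsSquare (a * b)
  D≡0⇒IsSquare-* {t} {a} {b} 2≢0 D≡0 with h , 2*h≡1 ← inverse 2# 2≢0 = h * s , (begin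
    h * s * (h * s)              ≡⟨ solve 2 (λ h s → h :* s :* (h :* s) := h :* h :* (s :* s)) refl h s ⟩
    h * h * (s * s)              ≡⟨ cong (h * h *_) (D≡0⇒square≡4* D≡0) ⟩
    h * h * (2# * 2# * (a * b))  ≡⟨ solve 2 (λ h p → h :* h :* (con 2 :* con 2 :* p)
                                                   := con 2 :* h :* (con 2 :* h) :* p) refl h (a * b) ⟩
    2# * h * (2# * h) * (a * b)  ≡⟨ cong (λ z → z * z * (a * b)) 2*h≡1 ⟩
    1# * 1# * (a * b)            ≡⟨ solve 1 (λ p → con 1 :* con 1 :* p := p) refl (a * b) ⟩
    a * b                        ∎)
    where s = t - (a + b)

  char2⇒square-injective : 2# ≡ 0# → ∀ {x y} → x * x ≡ y * y → x ≡ y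
  char2⇒square-injective 2≡0 {x} {y} x*x≡y*y =
    x∙y⁻¹≈ε⇒x≈y x y (x*x≡0⇒x≡0 (+-cancelʳ (y * y) _ _ (begin
      d * d + y * y                     ≡⟨ solve 2 (λ d y → d :* d :+ y :* y := d :* d :+ y :* y :+ con 0 :* (d :* y)) refl d y ⟩
      d * d + y * y + 0# * (d * y)      ≡⟨ cong (λ z → d * d + y * y + z * (d * y)) (sym 2≡0) ⟩
      d * d + y * y + 2# * (d * y)      ≡⟨ solve 2 (λ d y → d :* d :+ y :* y :+ con 2 :* (d :* y) := (d :+ y) :* (d :+ y)) refl d y ⟩
      (d + y) * (d + y)                 ≡⟨ cong (λ z → z * z) (sym (x≡x-y+y x y)) ⟩
      x * x                             ≡⟨ x*x≡y*y ⟩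
      y * y                             ≡⟨ sym (+-identityˡ (y * y)) ⟩
      0# + y * y                        ∎)))
    where d = x - y

  char2⇒IsSquare : 2# ≡ 0# → ∀ x → IsSquare x
  char2⇒IsSquare 2≡0 = finite-injective⇒surjective enum (λ x → x * x) (char2⇒square-injective 2≡0)

lemma4p4 : (q : ℕ) → OddPrimePower q → (F : FiniteField q) →
    let open FiniteField F in
    (t r₁ r₂ : Carrier) → t ≢ 0# → r₁ ≢ 0# → r₂ ≢ 0# →
    D t r₁ r₂ ≡ 0# → (η t ≡ η r₁) × (η r₁ ≡ η r₂)
lemma4p4 q _ F t r₁ r₂ t≢0 r₁≢0 r₂≢0 D≡0 = η-equal (2# ≟ 0#)
  where
    open FiniteField F
    open Squares F

    η-equal : Dec (2# ≡ 0#) → (η t ≡ η r₁) × (η r₁ ≡ η r₂)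
    η-equal (yes 2≡0) = trans (η≡1 t≢0) (sym (η≡1 r₁≢0)) , trans (η≡1 r₁≢0) (sym (η≡1 r₂≢0))
      where
        η≡1 : ∀ {x} → x ≢ 0# → η x ≡ + 1
        η≡1 {x} x≢0 = η-square x≢0 (char2⇒IsSquare 2≡0 x)
    η-equal (no 2≢0) = η-cong-IsSquare-* t≢0 r₁≢0 (D≡0⇒IsSquare-* 2≢0 (trans (sym (D-rotate t r₁ r₂)) D≡0))
                     , η-cong-IsSquare-* r₁≢0 r₂≢0 (D≡0⇒IsSquare-* 2≢0 D≡0)
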